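{- Let $A$ be a meet-complemented lattice in which both $\Box a$ and $\Diamond a$ exist for every $a\in A$. If the infimum $\bigwedge\{\Box^n a: n\in\mathbb{N}\}$ exists for every $a\in A$, then for every $a\in A$ the element $Ba$ exists and $Ba=\bigwedge\{\Box^n a: n\in\mathbb{N}\}$.
   Context: A meet-complemented lattice is a lattice $(A,\wedge,\vee)$, not necessarily distributive, such that for every $a\in A$ the element $\neg a=\max\{b\in A: a\wedge b\le c\text{ for all }c\in A\}$ exists; it is bounded, with least element $0$ and greatest element $1$. For $a\in A$, $\Box a=\max\{b\in A: a\vee\neg b=1\}$, $\Diamond a=\min\{b\in A: \neg a\vee b=1\}$, $\Box^0a=a$, $\Box^{n+1}a=\Box\Box^n a$, and $Ba=\max\{b\in A: b\le a\text{ and } b\vee\neg b=1\}$ (the greatest Boolean element below $a$). Here $\mathbb{N}$ includes $0$. -}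

module Defs where

open import Level using (Level; _⊔_)
open import Data.Nat using (ℕ; zero; suc)
open import Data.Product using (Σ; _×_; _,_; proj₁)
open import Relation.Binary.Lattice.Bundles using (BoundedLattice)

module _ {c ℓ₁ ℓ₂ : Level} (L : BoundedLattice c ℓ₁ ℓ₂) where
  open BoundedLattice L

  IsMax : ∀ {p} → (Carrier → Set p) → Carrier → Set (c ⊔ ℓ₂ ⊔ p)
  IsMax P m = P m × (∀ b → P b → b ≤ m)

  IsMin : ∀ {p} → (Carrier → Set p) → Carrier → Set (c ⊔ ℓ₂ ⊔ p)
  IsMin P m = P m × (∀ b → P b → m ≤ b)

  IsInfOf : (ℕ → Carrier) → Carrier → Set (c ⊔ ℓ₂)
  IsInfOf f i = (∀ n → i ≤ f n) × (∀ b → (∀ n → b ≤ f n) → b ≤ i)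

  MeetComplemented : Set (c ⊔ ℓ₂)
  MeetComplemented = ∀ a → Σ Carrier (IsMax (λ b → ∀ x → a ∧ b ≤ x))

  module _ (mc : MeetComplemented) where
    neg : Carrier → Carrier
    neg a = proj₁ (mc a)

    HasBox : Set (c ⊔ ℓ₁ ⊔ ℓ₂)
    HasBox = ∀ a → Σ Carrier (IsMax (λ b → (a ∨ neg b) ≈ ⊤))

    HasDiamond : Set (c ⊔ ℓ₁ ⊔ ℓ₂)
    HasDiamond = ∀ a → Σ Carrier (IsMin (λ b → (neg a ∨ b) ≈ ⊤))

    BooleanBelow : Carrier → Carrier → Set (ℓ₁ ⊔ ℓ₂)
    BooleanBelow a b = b ≤ a × (b ∨ neg b) ≈ ⊤

    module _ (box : HasBox) where
      □ : Carrier → Carrier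
      □ a = proj₁ (box a)

      □^ : ℕ → Carrier → Carrier
      □^ zero a = a
      □^ (suc n) a = □ (□^ n a)

module Submission where

-- In a meet-complemented lattice write Boolean b for b ∨ ¬b = 1.
-- By the defining extremal properties of □ and ◇,
--      c ≤ □x  iff  x ∨ ¬c = 1   and   ◇c ≤ x  iff  ¬c ∨ x = 1,
-- so ◇ is left adjoint to □ (we only need c ≤ □x ⇒ ◇c ≤ x).  Two consequences:
--   * □ keeps every Boolean element it is above: if b is Boolean and b ≤ x then
--     b ≤ □x, since x ∨ ¬b ≥ b ∨ ¬b = 1; hence a Boolean b ≤ a lies below
--     every □ⁿa and so below their infimum i;
--   * an element c with ◇c ≤ c is Boolean.  The infimum i satisfies
--     i ≤ □ⁿ⁺¹a = □(□ⁿa), so ◇i ≤ □ⁿa for all n, so ◇i ≤ i.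
-- Thus i is a Boolean element below a (as i ≤ □⁰a = a) that dominates every
-- Boolean element below a, i.e. Ba exists and equals i.

open import Defs hiding (□)
open import Level using (Level)
open import Data.Nat using (zero; suc)
open import Data.Product using (Σ; _×_; _,_; proj₁; proj₂)
open import Relation.Binary.Lattice.Bundles using (BoundedLattice)
import Relation.Binary.Lattice.Properties.JoinSemilattice as JoinProperties

module MeetComplementedLattice {c ℓ₁ ℓ₂ : Level} (L : BoundedLattice c ℓ₁ ℓ₂)
                               (mc : MeetComplemented L) where
  open BoundedLattice L
  open JoinProperties joinSemilattice using (∨-monotonic; ∨-comm)

  ¬_ : Carrier → Carrier
  ¬_ = neg L mc

  Boolean : Carrier → Set ℓ₁
  Boolean b = (b ∨ ¬ b) ≈ ⊤

  ⊤-upward : ∀ {x y} → x ≈ ⊤ → x ≤ y → y ≈ ⊤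
  ⊤-upward {x} {y} x≈⊤ x≤y = antisym (maximum y) (trans (reflexive (Eq.sym x≈⊤)) x≤y)

  ∨≈⊤-comm : ∀ {x y} → (x ∨ y) ≈ ⊤ → (y ∨ x) ≈ ⊤
  ∨≈⊤-comm {x} {y} e = Eq.trans (∨-comm y x) e

  ¬-disjoint : ∀ a x → a ∧ ¬ a ≤ x
  ¬-disjoint a = proj₁ (proj₂ (mc a))

  -- Negation is antitone: ¬y is disjoint from x whenever x ≤ y.
  ¬-antitone : ∀ {x y} → x ≤ y → ¬ y ≤ ¬ x
  ¬-antitone {x} {y} x≤y = proj₂ (proj₂ (mc x)) (¬ y) x∧¬y-disjoint
    where
    x∧¬y-disjoint : ∀ z → x ∧ ¬ y ≤ z
    x∧¬y-disjoint z =
      trans (∧-greatest (trans (x∧y≤x x (¬ y)) x≤y) (x∧y≤y x (¬ y))) (¬-disjoint y z)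

  module WithBox (box : HasBox L mc) where

    □_ : Carrier → Carrier
    □_ = Defs.□ L mc box

    ≤□⇒covers : ∀ {c x} → c ≤ □ x → (x ∨ ¬ c) ≈ ⊤
    ≤□⇒covers {c} {x} c≤□x =
      ⊤-upward (proj₁ (proj₂ (box x))) (∨-monotonic refl (¬-antitone c≤□x))

    covers⇒≤□ : ∀ {c x} → (x ∨ ¬ c) ≈ ⊤ → c ≤ □ x
    covers⇒≤□ {c} {x} = proj₂ (proj₂ (box x)) c

    boolean-≤□ : ∀ {b x} → Boolean b → b ≤ x → b ≤ □ x
    boolean-≤□ {b} {x} b-boolean b≤x =
      covers⇒≤□ (⊤-upward b-boolean (∨-monotonic b≤x refl))

    boolean-≤□^ : ∀ {b a} → Boolean b → b ≤ a → ∀ n → b ≤ □^ L mc box n a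
    boolean-≤□^ b-boolean b≤a zero    = b≤a
    boolean-≤□^ b-boolean b≤a (suc n) = boolean-≤□ b-boolean (boolean-≤□^ b-boolean b≤a n)

    module WithDiamond (dia : HasDiamond L mc) where

      ◇_ : Carrier → Carrier
      ◇ c = proj₁ (dia c)

      -- ◇c ≤ x ⇒ ¬c ∨ x = ⊤, since ¬c ∨ ◇c = ⊤ by definition of ◇.
      ◇≤⇒covers : ∀ {c x} → ◇ c ≤ x → (¬ c ∨ x) ≈ ⊤
      ◇≤⇒covers {c} {x} ◇c≤x = ⊤-upward (proj₁ (proj₂ (dia c))) (∨-monotonic refl ◇c≤x)

      -- ◇ is left adjoint to □ (the direction needed here).
      ≤□⇒◇≤ : ∀ {c x} → c ≤ □ x → ◇ c ≤ x
      ≤□⇒◇≤ {c} {x} c≤□x = proj₂ (proj₂ (dia c)) x (∨≈⊤-comm (≤□⇒covers c≤□x))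

      ◇-deflated⇒boolean : ∀ {c} → ◇ c ≤ c → Boolean c
      ◇-deflated⇒boolean ◇c≤c = ∨≈⊤-comm (◇≤⇒covers ◇c≤c)

      -- The infimum of the iterates □ⁿa is Boolean: ◇i is a lower bound of them,
      -- because i ≤ □ⁿ⁺¹a = □(□ⁿa) gives ◇i ≤ □ⁿa.
      inf-of-iterates-boolean : ∀ {a i} → IsInfOf L (λ n → □^ L mc box n a) i → Boolean i
      inf-of-iterates-boolean {a} {i} (i-lower , i-greatest) =
        ◇-deflated⇒boolean (i-greatest (◇ i) (λ n → ≤□⇒◇≤ (i-lower (suc n))))

proposition12 : {c ℓ₁ ℓ₂ : Level} (L : BoundedLattice c ℓ₁ ℓ₂)
    → (mc : MeetComplemented L) (box : HasBox L mc) → HasDiamond L mc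
    → (inf : ∀ a → Σ (BoundedLattice.Carrier L) (IsInfOf L (λ n → □^ L mc box n a)))
    → ∀ a → Σ (BoundedLattice.Carrier L) (λ Ba →
    IsMax L (BooleanBelow L mc a) Ba × BoundedLattice._≈_ L Ba (Σ.proj₁ (inf a)))
proposition12 L mc box dia inf a =
  i , ((i-lower 0 , inf-of-iterates-boolean (proj₂ (inf a))) , below-i) , Eq.refl
  where
  open BoundedLattice L using (_≤_; module Eq)
  open MeetComplementedLattice L mc
  open WithBox box
  open WithDiamond dia

  i = proj₁ (inf a)
  i-lower = proj₁ (proj₂ (inf a))

  below-i : ∀ b → BooleanBelow L mc a b → b ≤ i
  below-i b (b≤a , b-boolean) = proj₂ (proj₂ (inf a)) b (boolean-≤□^ b-boolean b≤a)
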